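{- Fix the type of a $\oplus$-BAC Chain of length $m\ge1$ with cycle sizes $(n_1,\dots,n_m)$ (i.e. fix its unsigned interaction graph), and consider all $\oplus$-BAC Chains of this type (all choices of signs of the literals). These networks form exactly one behavioural isomorphism class if $m-1$ is not a multiple of $3$, and exactly two behavioural isomorphism classes if $m-1$ is a multiple of $3$.
   Context: A $\oplus$-BAC Chain of length $m$ consists of directed simple cycles $\mathcal{C}_1,\dots,\mathcal{C}_m$ (a cycle may be a self-loop) and $m-1$ distinct intersection automata $o_1,\dots,o_{m-1}$ such that $\mathcal{C}_k\cap\mathcal{C}_{k+1}=\{o_k\}$ for $1\le k<m$, non-consecutive cycles are disjoint, and every automaton lies on some cycle; writing $\mathcal{C}_k=(i^k_1,\dots,i^k_{n_k})$, one has $o_k=i^k_1=i^{k+1}_{\ell_k}$. Every non-intersection automaton $i$ has local function $f_i(x)=\sigma_i(x_{p})$ where $p$ is its predecessor on its cycle, and each $o_k$ has $f_{o_k}(x)=\sigma(x_p)\oplus\sigma'(x_{p'})$ where $p,p'$ are its predecessors on $\mathcal{C}_k$ and $\mathcal{C}_{k+1}$; each $\sigma$ is identity or negation. For $W\subseteq V$, $F_W(x)_i=f_i(x)$ if $i\in W$ and $x_i$ otherwise. Two BANs $\mathcal{N},\mathcal{N}'$ on $n$ automata are behaviourally isomorphic if there exist bijections $\varphi:V\to V'$ and $\phi:\{0,1\}^n\to\{0,1\}^n$ with $\phi(F_W(x))=F'_{\varphi(W)}(\phi(x))$ for all $W\subseteq V$ and all $x$. -}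

module Defs where

open import Data.Nat using (ℕ; zero; suc; _<_; _∸_; _≤_)
open import Data.Nat.Divisibility using (_∣_)
open import Data.Fin using (Fin; zero; suc; toℕ; fromℕ; inject₁; _≟_)
open import Data.Vec using (Vec; lookup; tabulate)
open import Data.Bool using (Bool; true; false; if_then_else_; _xor_)
open import Data.Product using (Σ; ∃; _×_)
open import Data.Sum using (_⊎_)
open import Data.Empty using (⊥)
open import Relation.Nullary using (¬_)
open import Relation.Nullary.Decidable using (⌊_⌋)
open import Relation.Binary.PropositionalEquality using (_≡_)
open import Function.Bundles using (_↔_; Inverse)

BAN : ℕ → Set
BAN n = Fin n → Vec Bool n → Bool

-- Subsets W ⊆ V as characteristic vectors.
Subset : ℕ → Set
Subset n = Vec Bool n

update : ∀ {n} → BAN n → Subset n → Vec Bool n → Vec Bool n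
update f W x = tabulate λ i → if lookup W i then f i x else lookup x i

image : ∀ {n} → (Fin n ↔ Fin n) → Subset n → Subset n
image φ W = tabulate λ j → lookup W (Inverse.from φ j)

BehIso : ∀ {n} → BAN n → BAN n → Set
BehIso {n} f g =
  Σ (Fin n ↔ Fin n) λ φ →
  Σ (Vec Bool n ↔ Vec Bool n) λ ϕ →
  ∀ (W : Subset n) (x : Vec Bool n) →
    Inverse.to ϕ (update f W x) ≡ update g (image φ W) (Inverse.to ϕ x)

-- ⊕-BAC chains.
-- m cycles C_0 … C_{m-1}; cycle k is the sequence of automata
-- C k = (i_0, …, i_{len k}) with arcs i_j → i_{j+1} and i_{len k} → i_0
-- (len k = 0 is a self-loop).

predPos : ∀ {l} → Fin (suc l) → Fin (suc l)
predPos {l} zero = fromℕ l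
predPos (suc j) = inject₁ j

OnCycle : ∀ {n m} {len : Fin m → ℕ} →
          ((k : Fin m) → Vec (Fin n) (suc (len k))) → Fin m → Fin n → Set
OnCycle C k v = ∃ λ j → lookup (C k) j ≡ v

record IsChain {n m : ℕ} (len : Fin m → ℕ)
               (C : (k : Fin m) → Vec (Fin n) (suc (len k))) : Set where
  field
    simple   : ∀ k (j j' : Fin (suc (len k))) →
               lookup (C k) j ≡ lookup (C k) j' → j ≡ j'
    meet     : ∀ (k k' : Fin m) → toℕ k' ≡ suc (toℕ k) →
               ∃ λ o → OnCycle C k o × OnCycle C k' o ×
                       (∀ v → OnCycle C k v → OnCycle C k' v → v ≡ o)
    disjoint : ∀ (k k' : Fin m) → suc (toℕ k) < toℕ k' →
               ∀ v → OnCycle C k v → OnCycle C k' v → ⊥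
    cover    : ∀ v → ∃ λ k → OnCycle C k v

-- Signs of literals: one per arc, i.e. per (cycle, position). The arc into
-- i^k_j from its predecessor carries σ = id (false) or negation (true).
Signs : ∀ {m} → (Fin m → ℕ) → Set
Signs {m} len = (k : Fin m) → Fin (suc (len k)) → Bool

xorSum : ∀ {p} → (Fin p → Bool) → Bool
xorSum {zero} f = false
xorSum {suc p} f = f zero xor xorSum (λ i → f (suc i))

-- A non-intersection automaton has one incoming arc (f_v = σ(x_p)), an
-- intersection automaton o_k has two (f = σ(x_p) ⊕ σ'(x_p')).
chainBAN : ∀ {n m} {len : Fin m → ℕ} →
           ((k : Fin m) → Vec (Fin n) (suc (len k))) → Signs len → BAN n
chainBAN C s v x =
  xorSum λ k → xorSum λ j →
    if ⌊ lookup (C k) j ≟ v ⌋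
    then s k j xor lookup x (lookup (C k) (predPos j))
    else false

OneClass : ∀ {n m} {len : Fin m → ℕ} →
           ((k : Fin m) → Vec (Fin n) (suc (len k))) → Set
OneClass {len = len} C =
  ∀ (s s' : Signs len) → BehIso (chainBAN C s) (chainBAN C s')

TwoClasses : ∀ {n m} {len : Fin m → ℕ} →
             ((k : Fin m) → Vec (Fin n) (suc (len k))) → Set
TwoClasses {len = len} C =
  Σ (Signs len) λ s₁ → Σ (Signs len) λ s₂ →
    ¬ BehIso (chainBAN C s₁) (chainBAN C s₂) ×
    (∀ (s : Signs len) →
       BehIso (chainBAN C s) (chainBAN C s₁) ⊎ BehIso (chainBAN C s) (chainBAN C s₂))

module Submission where

-- For fixed cycles C, the networks chainBAN C s are affine over GF(2) in the
-- configuration and linear in the signs s (SignedNetworks).  Translating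
-- configurations by a fixed point of the network with signs s ⊕ s′ is a behavioural
-- isomorphism from s to s′, and fixed points of the parallel update are preserved
-- by isomorphisms.  So the classes are governed by the fixed points of the unsigned
-- network (the kernel of a linear map δ on Vec Bool n): a trivial kernel makes δ onto
-- (an injective endomap of a finite set is onto) and gives one class; a kernel
-- detected at a single automaton, together with a sign choice without fixed point,
-- gives exactly two.  For a chain, a fixed point is constant along each cycle between
-- intersections (CycleLabelling), so it is determined by its values at the
-- intersections, which obey Y (i + 1) = Y i ⊕ Y (i - 1) with clamped boundary
-- conditions (ChainGeometry).  This recurrence has period 3 (BoundaryRecurrence),
-- which decides both kernel conditions; a single cycle is treated directly.

open import Defs
open import Data.Nat using (ℕ; zero; suc; _^_; _<_; _≤_; _∸_; _*_; pred; s≤s; z≤n)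
import Data.Nat.Properties as ℕ
open import Data.Nat.Divisibility using (_∣_; divides; _∣0)
open import Data.Fin using (Fin; zero; suc; toℕ; fromℕ; fromℕ<; inject₁; punchOut; combine; remQuot)
import Data.Fin.Properties as Fin
open import Data.Fin.Induction using (<-weakInduction; <-weakInduction-startingFrom)
open import Data.Vec using (Vec; []; _∷_; lookup; tabulate; replicate; zipWith)
open import Data.Vec.Properties
  using (lookup-zipWith; lookup-replicate; lookup∘tabulate; tabulate∘lookup; tabulate-cong;
         zipWith-identityˡ; zipWith-identityʳ; zipWith-distribʳ)
open import Data.Bool using (Bool; true; false; not; _∧_; _xor_; if_then_else_)
open import Data.Bool.Properties
  using (xor-same; xor-assoc; xor-comm; xor-identityʳ; xor-inverseʳ; ∧-zeroʳ; ∧-identityʳ; ∧-distribʳ-xor;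
         xor-∧-commutativeRing)
open import Relation.Nullary.Decidable using (⌊_⌋; ¬?; _×-dec_)
open import Function.Bundles using (_↔_; Inverse; mk↔ₛ′)
open import Function.Construct.Identity using (↔-id)
open import Function.Definitions using (Injective)
open import Data.Product using (∃; ∃₂; _×_; _,_; proj₁; proj₂)
open import Data.Sum using (_⊎_; inj₁; inj₂; [_,_]′)
open import Data.Empty using (⊥-elim)
open import Relation.Nullary using (¬_; Dec; yes; no)
open import Relation.Unary using (Decidable)
open import Relation.Binary.PropositionalEquality hiding ([_])
open import Relation.Binary.Definitions using (tri<; tri≈; tri>)
open import Function using (_∘_)
open import Algebra.Bundles using (CommutativeRing)
open import Algebra.Properties.CommutativeSemigroup (CommutativeRing.+-commutativeSemigroup xor-∧-commutativeRing) using (interchange)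

xor-interchange : ∀ a b c d → (a xor b) xor (c xor d) ≡ (a xor c) xor (b xor d)
xor-interchange = interchange

xor-cancelʳ : ∀ a b → (a xor b) xor b ≡ a
xor-cancelʳ a b = trans (xor-assoc a b b) (trans (cong (a xor_) (xor-same b)) (xor-identityʳ a))

xor-cancelˡ : ∀ a b → a xor (a xor b) ≡ b
xor-cancelˡ a b = trans (sym (xor-assoc a a b)) (cong (_xor b) (xor-same a))

true≢false : true ≢ false
true≢false ()

xor≡false⇒≡ : ∀ {a b} → a xor b ≡ false → a ≡ b
xor≡false⇒≡ {false} {false} _ = refl
xor≡false⇒≡ {true}  {true}  _ = refl

xorSum-cong : ∀ {p} {f g : Fin p → Bool} → (∀ i → f i ≡ g i) → xorSum f ≡ xorSum g
xorSum-cong {zero}  f≗g = refl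
xorSum-cong {suc p} f≗g = cong₂ _xor_ (f≗g zero) (xorSum-cong (λ i → f≗g (suc i)))

xorSum-xor : ∀ {p} (f g : Fin p → Bool) → xorSum (λ i → f i xor g i) ≡ xorSum f xor xorSum g
xorSum-xor {zero}  f g = refl
xorSum-xor {suc p} f g =
  trans (cong ((f zero xor g zero) xor_) (xorSum-xor (λ i → f (suc i)) (λ i → g (suc i))))
        (xor-interchange (f zero) (g zero) _ _)

xorSum-vanishing : ∀ {p} (f : Fin p → Bool) → (∀ i → f i ≡ false) → xorSum f ≡ false
xorSum-vanishing {zero}  f f≡0 = refl
xorSum-vanishing {suc p} f f≡0 = cong₂ _xor_ (f≡0 zero) (xorSum-vanishing _ (λ i → f≡0 (suc i)))

xorSum-single : ∀ {p} (f : Fin p → Bool) (i₀ : Fin p) →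
                (∀ i → i ≢ i₀ → f i ≡ false) → xorSum f ≡ f i₀
xorSum-single f zero off =
  trans (cong (f zero xor_) (xorSum-vanishing _ (λ i → off (suc i) λ ()))) (xor-identityʳ _)
xorSum-single f (suc i₀) off =
  trans (cong (_xor xorSum (λ i → f (suc i))) (off zero λ ()))
        (xorSum-single (λ i → f (suc i)) i₀ (λ i i≢i₀ → off (suc i) (i≢i₀ ∘ Fin.suc-injective)))

xorSum-pair : ∀ {p} (f : Fin p → Bool) (i₁ i₂ : Fin p) → i₁ ≢ i₂ →
              (∀ i → i ≢ i₁ → i ≢ i₂ → f i ≡ false) → xorSum f ≡ f i₁ xor f i₂
xorSum-pair f zero zero i₁≢i₂ off = ⊥-elim (i₁≢i₂ refl)
xorSum-pair f zero (suc i₂) _ off =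
  cong (f zero xor_) (xorSum-single (λ i → f (suc i)) i₂ (λ i i≢i₂ → off (suc i) (λ ()) (i≢i₂ ∘ Fin.suc-injective)))
xorSum-pair f (suc i₁) zero _ off =
  trans (cong (f zero xor_) (xorSum-single (λ i → f (suc i)) i₁ (λ i i≢i₁ → off (suc i) (i≢i₁ ∘ Fin.suc-injective) (λ ()))))
        (xor-comm (f zero) _)
xorSum-pair f (suc i₁) (suc i₂) i₁≢i₂ off =
  trans (cong (_xor xorSum (λ i → f (suc i))) (off zero (λ ()) (λ ())))
        (xorSum-pair (λ i → f (suc i)) i₁ i₂ (i₁≢i₂ ∘ cong suc)
                     (λ i i≢i₁ i≢i₂ → off (suc i) (i≢i₁ ∘ Fin.suc-injective) (i≢i₂ ∘ Fin.suc-injective)))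

xorSum-predPos : ∀ {l} (f : Fin (suc l) → Bool) → xorSum (λ j → f (predPos j)) ≡ xorSum f
xorSum-predPos {l} f = trans (xor-comm (f (fromℕ l)) _) (sym (xorSum-last f))
  where
  xorSum-last : ∀ {l} (f : Fin (suc l) → Bool) → xorSum f ≡ xorSum (λ j → f (inject₁ j)) xor f (fromℕ l)
  xorSum-last {zero}  f = xor-identityʳ _
  xorSum-last {suc l} f =
    trans (cong (f zero xor_) (xorSum-last (λ j → f (suc j)))) (sym (xor-assoc (f zero) _ _))

jump : ∀ {l} → (Fin (suc l) → Bool) → Fin (suc l) → Bool
jump g j = g j xor g (predPos j)

jumps-cancel : ∀ {l} (g : Fin (suc l) → Bool) → xorSum (jump g) ≡ false
jumps-cancel g = trans (xorSum-xor g (λ j → g (predPos j)))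
  (trans (cong (xorSum g xor_) (xorSum-predPos g)) (xor-same (xorSum g)))

module CycleLabelling {l} (S : Fin (suc l) → Set) (S? : Decidable S) (g : Fin (suc l) → Bool)
                      (step : ∀ j → ¬ S j → g j ≡ g (predPos j)) where

  SpecialValue : Fin (suc l) → Set
  SpecialValue j = ∃ λ s → S s × g j ≡ g s

  advance : ∀ j → SpecialValue (inject₁ j) → SpecialValue (suc j)
  advance j (s , sₛ , e) with S? (suc j)
  ... | yes sⱼ = suc j , sⱼ , refl
  ... | no ¬sⱼ = s , sₛ , trans (step (suc j) ¬sⱼ) e

  -- If some position is special, every label is the label of a special position:
  -- walk forward from the special position to the end, wrap around, and walk again.
  walk : ∃ S → ∀ j → SpecialValue j
  walk (s₀ , s₀ₛ) = <-weakInduction SpecialValue atZero advance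
    where
    atLast : SpecialValue (fromℕ l)
    atLast = <-weakInduction-startingFrom SpecialValue (s₀ , s₀ₛ , refl) advance (Fin.≤fromℕ s₀)
    atZero : SpecialValue zero
    atZero with S? zero
    ... | yes zₛ = zero , zₛ , refl
    ... | no ¬zₛ = let (s , sₛ , e) = atLast in s , sₛ , trans (step zero ¬zₛ) e

-- On a cycle whose special positions are among a and b (with a special),
-- the label just before a is the label at b.  (If the label before a is already
-- the label at a, then a is not a jump, and b is the only special position left.)
label-before-special : ∀ {l} (S : Fin (suc l) → Set) (S? : Decidable S) (g : Fin (suc l) → Bool) →
                       (∀ j → ¬ S j → g j ≡ g (predPos j)) →
                       ∀ a b → S a → (∀ j → S j → j ≡ a ⊎ j ≡ b) → g (predPos a) ≡ g b
label-before-special S S? g step a b aₛ onlyAB with CycleLabelling.walk S S? g step (a , aₛ) (predPos a)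
... | s , sₛ , e with onlyAB s sₛ
...   | inj₂ refl = e
...   | inj₁ refl = reach-b (CycleLabelling.walk (λ j → j ≡ b) (λ j → j Fin.≟ b) g no-jump (b , refl) (predPos a))
  where
  reach-b : (∃ λ s → s ≡ b × g (predPos a) ≡ g s) → g (predPos a) ≡ g b
  reach-b (.b , refl , e′) = e′
  jump-a : jump g a ≡ false
  jump-a = trans (cong (g a xor_) e) (xor-same (g a))
  jump-off-b : ∀ j → j ≢ b → jump g j ≡ false
  jump-off-b j j≢b with S? j
  ... | no ¬jₛ = trans (cong (_xor g (predPos j)) (step j ¬jₛ)) (xor-same (g (predPos j)))
  ... | yes jₛ with onlyAB j jₛ
  ...   | inj₁ refl = jump-a
  ...   | inj₂ j≡b = ⊥-elim (j≢b j≡b)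
  no-jump : ∀ j → j ≢ b → g j ≡ g (predPos j)
  no-jump j j≢b = xor≡false⇒≡ (jump-off-b j j≢b)

infixl 6 _⊕_
_⊕_ : ∀ {n} → Vec Bool n → Vec Bool n → Vec Bool n
_⊕_ = zipWith _xor_

𝟎 : ∀ {n} → Vec Bool n
𝟎 = replicate _ false

lookup-⊕ : ∀ {n} (x y : Vec Bool n) i → lookup (x ⊕ y) i ≡ lookup x i xor lookup y i
lookup-⊕ x y i = lookup-zipWith _xor_ i x y

vec-ext : ∀ {n} {x y : Vec Bool n} → (∀ i → lookup x i ≡ lookup y i) → x ≡ y
vec-ext {x = x} {y} x≗y = trans (sym (tabulate∘lookup x)) (trans (tabulate-cong x≗y) (tabulate∘lookup y))

⊕-identityˡ : ∀ {n} (x : Vec Bool n) → 𝟎 ⊕ x ≡ x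
⊕-identityˡ = zipWith-identityˡ (λ _ → refl)

⊕-identityʳ : ∀ {n} (x : Vec Bool n) → x ⊕ 𝟎 ≡ x
⊕-identityʳ = zipWith-identityʳ xor-identityʳ

⊕-self : ∀ {n} (x : Vec Bool n) → x ⊕ x ≡ 𝟎
⊕-self x = vec-ext λ i → trans (lookup-⊕ x x i) (trans (xor-same (lookup x i)) (sym (lookup-replicate i false)))

⊕-cancelʳ : ∀ {n} (x y : Vec Bool n) → x ⊕ y ⊕ y ≡ x
⊕-cancelʳ x y = vec-ext λ i →
  trans (lookup-⊕ (x ⊕ y) y i) (trans (cong (_xor lookup y i) (lookup-⊕ x y i)) (xor-cancelʳ _ _))

⊕-interchange : ∀ {n} (a b c d : Vec Bool n) → (a ⊕ b) ⊕ (c ⊕ d) ≡ (a ⊕ c) ⊕ (b ⊕ d)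
⊕-interchange a b c d = vec-ext λ i → begin
  lookup ((a ⊕ b) ⊕ (c ⊕ d)) i                             ≡⟨ lookup-⊕ (a ⊕ b) (c ⊕ d) i ⟩
  lookup (a ⊕ b) i xor lookup (c ⊕ d) i                     ≡⟨ cong₂ _xor_ (lookup-⊕ a b i) (lookup-⊕ c d i) ⟩
  (lookup a i xor lookup b i) xor (lookup c i xor lookup d i) ≡⟨ xor-interchange (lookup a i) (lookup b i) (lookup c i) (lookup d i) ⟩
  (lookup a i xor lookup c i) xor (lookup b i xor lookup d i) ≡⟨ sym (cong₂ _xor_ (lookup-⊕ a c i) (lookup-⊕ b d i)) ⟩
  lookup (a ⊕ c) i xor lookup (b ⊕ d) i                     ≡⟨ sym (lookup-⊕ (a ⊕ c) (b ⊕ d) i) ⟩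
  lookup ((a ⊕ c) ⊕ (b ⊕ d)) i                             ∎
  where open ≡-Reasoning

⊕-solveˡ : ∀ {n} {x y z : Vec Bool n} → x ⊕ y ≡ z → x ≡ z ⊕ y
⊕-solveˡ {x = x} {y} refl = sym (⊕-cancelʳ x y)

⊕≡𝟎⇒≡ : ∀ {n} {x y : Vec Bool n} → x ⊕ y ≡ 𝟎 → x ≡ y
⊕≡𝟎⇒≡ {y = y} x⊕y≡𝟎 = trans (⊕-solveˡ x⊕y≡𝟎) (⊕-identityˡ y)

Fin-injective⇒surjective : ∀ {N} (g : Fin N → Fin N) → Injective _≡_ _≡_ g → ∀ y → ∃ λ x → g x ≡ y
Fin-injective⇒surjective {suc N} g g-inj y with Fin.any? (λ x → g x Fin.≟ y)
... | yes hit = hit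
... | no miss = ⊥-elim (ℕ.1+n≰n (Fin.injective⇒≤ h-inj))
  where
  -- g misses y, so squeezing y out of its codomain injects Fin (suc N) into Fin N
  h : Fin (suc N) → Fin N
  h x = punchOut {i = y} {j = g x} (λ y≡gx → miss (x , sym y≡gx))
  h-inj : Injective _≡_ _≡_ h
  h-inj {x} {x′} hx≡hx′ =
    g-inj (Fin.punchOut-injective (λ y≡gx → miss (x , sym y≡gx)) (λ y≡gx′ → miss (x′ , sym y≡gx′)) hx≡hx′)

encode : ∀ {n} → Vec Bool n → Fin (2 ^ n)
encode []      = zero
encode (b ∷ x) = combine (Inverse.from Fin.2↔Bool b) (encode x)

decode : ∀ {n} → Fin (2 ^ n) → Vec Bool n
decode {zero}  _ = []
decode {suc n} i = Inverse.to Fin.2↔Bool (proj₁ (remQuot {2} (2 ^ n) i)) ∷ decode (proj₂ (remQuot {2} (2 ^ n) i))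

decode-encode : ∀ {n} (x : Vec Bool n) → decode (encode x) ≡ x
decode-encode []              = refl
decode-encode {suc n} (b ∷ x) =
  trans (cong (λ (p : Fin 2 × Fin (2 ^ n)) → Inverse.to Fin.2↔Bool (proj₁ p) ∷ decode (proj₂ p))
              (Fin.remQuot-combine (Inverse.from Fin.2↔Bool b) (encode x)))
        (cong₂ _∷_ (Inverse.strictlyInverseˡ Fin.2↔Bool b) (decode-encode x))

encode-decode : ∀ {n} (i : Fin (2 ^ n)) → encode (decode {n} i) ≡ i
encode-decode {zero}  zero = refl
encode-decode {suc n} i =
  trans (cong₂ combine (Inverse.strictlyInverseʳ Fin.2↔Bool (proj₁ (remQuot {2} (2 ^ n) i)))
                       (encode-decode {n} (proj₂ (remQuot {2} (2 ^ n) i))))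
        (Fin.combine-remQuot {2} (2 ^ n) i)

Vec-injective⇒surjective : ∀ {n} (h : Vec Bool n → Vec Bool n) → Injective _≡_ _≡_ h →
                           ∀ y → ∃ λ x → h x ≡ y
Vec-injective⇒surjective {n} h h-inj y =
  let (i , gi≡y) = Fin-injective⇒surjective g g-inj (encode y)
  in decode i , trans (sym (decode-encode _)) (trans (cong decode gi≡y) (decode-encode y))
  where
  g : Fin (2 ^ n) → Fin (2 ^ n)
  g = encode ∘ h ∘ decode
  decode-inj : Injective _≡_ _≡_ (decode {n})
  decode-inj {i} {j} e = trans (sym (encode-decode {n} i)) (trans (cong encode e) (encode-decode {n} j))
  encode-inj : Injective _≡_ _≡_ (encode {n})
  encode-inj {x} {x′} e = trans (sym (decode-encode x)) (trans (cong decode e) (decode-encode x′))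
  g-inj : Injective _≡_ _≡_ g
  g-inj = decode-inj ∘ h-inj ∘ encode-inj

Linear : ∀ {n} → (Vec Bool n → Vec Bool n) → Set
Linear h = ∀ x y → h (x ⊕ y) ≡ h x ⊕ h y

trivialKernel⇒surjective : ∀ {n} (h : Vec Bool n → Vec Bool n) → Linear h →
                           (∀ z → h z ≡ 𝟎 → z ≡ 𝟎) → ∀ y → ∃ λ x → h x ≡ y
trivialKernel⇒surjective h h-lin ker = Vec-injective⇒surjective h h-inj
  where
  h-inj : Injective _≡_ _≡_ h
  h-inj {x} {y} hx≡hy = ⊕≡𝟎⇒≡ (ker (x ⊕ y) (trans (h-lin x y) (trans (cong (h x ⊕_) (sym hx≡hy)) (⊕-self (h x)))))

linear-𝟎 : ∀ {n} {h : Vec Bool n → Vec Bool n} → Linear h → h 𝟎 ≡ 𝟎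
linear-𝟎 {h = h} h-lin = trans (cong h (sym (⊕-self 𝟎))) (trans (h-lin 𝟎 𝟎) (⊕-self (h 𝟎)))

-- Fixed points of the parallel update F_V are invariant under behavioural
-- isomorphism (take W = V: the image of a fixed point is a fixed point).
BehIso-fixedPoint : ∀ {n} {f g : BAN n} → BehIso f g →
                    ∀ x → (∀ v → f v x ≡ lookup x v) → ∃ λ y → ∀ v → g v y ≡ lookup y v
BehIso-fixedPoint {n} {f} {g} (φ , ϕ , commute) x x-fixed = y , λ v → sym (y-fixed v)
  where
  V : Subset n
  V = replicate n true
  y : Vec Bool n
  y = Inverse.to ϕ x
  update-x : update f V x ≡ x
  update-x = vec-ext λ i →
    trans (lookup∘tabulate _ i) (trans (cong (λ b → if b then f i x else lookup x i) (lookup-replicate i true)) (x-fixed i))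
  y-fixed : ∀ v → lookup y v ≡ g v y
  y-fixed v = begin
    lookup y v                                          ≡⟨ cong (λ z → lookup (Inverse.to ϕ z) v) (sym update-x) ⟩
    lookup (Inverse.to ϕ (update f V x)) v              ≡⟨ cong (λ z → lookup z v) (commute V x) ⟩
    lookup (update g (image φ V) y) v                   ≡⟨ lookup∘tabulate _ v ⟩
    (if lookup (image φ V) v then g v y else lookup y v) ≡⟨ cong (λ b → if b then g v y else lookup y v) image-V ⟩
    g v y                                               ∎
    where
    open ≡-Reasoning
    image-V : lookup (image φ V) v ≡ true
    image-V = trans (lookup∘tabulate _ v) (lookup-replicate (Inverse.from φ v) true)

-- The ⊕-BAC networks on a fixed family of cycles are affine over GF(2):
-- chainBAN C s x = c s ⊕ A x with A linear and c linear in the signs.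
module SignedNetworks {n m} {len : Fin m → ℕ} (C : (k : Fin m) → Vec (Fin n) (suc (len k))) where

  infixl 6 _⊕ˢ_
  _⊕ˢ_ : Signs len → Signs len → Signs len
  (s ⊕ˢ s′) k j = s k j xor s′ k j

  𝟎ˢ : Signs len
  𝟎ˢ k j = false

  arcTerm : Signs len → Vec Bool n → Fin n → (k : Fin m) → Fin (suc (len k)) → Bool
  arcTerm s x v k j = if ⌊ lookup (C k) j Fin.≟ v ⌋ then s k j xor lookup x (lookup (C k) (predPos j)) else false

  chainBAN-cong : ∀ s s′ → (∀ k j → s k j ≡ s′ k j) → ∀ v x → chainBAN C s v x ≡ chainBAN C s′ v x
  chainBAN-cong s s′ s≗s′ v x = xorSum-cong λ k → xorSum-cong λ j →
    cong (λ b → if ⌊ lookup (C k) j Fin.≟ v ⌋ then b xor lookup x (lookup (C k) (predPos j)) else false) (s≗s′ k j)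

  chainBAN-bilinear : ∀ s s′ v x y → chainBAN C (s ⊕ˢ s′) v (x ⊕ y) ≡ chainBAN C s v x xor chainBAN C s′ v y
  chainBAN-bilinear s s′ v x y =
    trans (xorSum-cong λ k → trans (xorSum-cong (arc k)) (xorSum-xor (arcTerm s x v k) (arcTerm s′ y v k)))
          (xorSum-xor (λ k → xorSum (arcTerm s x v k)) (λ k → xorSum (arcTerm s′ y v k)))
    where
    arc : ∀ k j → arcTerm (s ⊕ˢ s′) (x ⊕ y) v k j ≡ arcTerm s x v k j xor arcTerm s′ y v k j
    arc k j with ⌊ lookup (C k) j Fin.≟ v ⌋
    ... | false = refl
    ... | true  = trans (cong ((s k j xor s′ k j) xor_) (lookup-⊕ x y _)) (xor-interchange (s k j) (s′ k j) _ _)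

  IsFixed : Signs len → Vec Bool n → Set
  IsFixed t x = ∀ v → chainBAN C t v x ≡ lookup x v

  HasFixedPoint : Signs len → Set
  HasFixedPoint t = ∃ (IsFixed t)

  defect : Signs len → Vec Bool n → Vec Bool n
  defect t x = tabulate λ v → chainBAN C t v x xor lookup x v

  lookup-defect : ∀ t x v → lookup (defect t x) v ≡ chainBAN C t v x xor lookup x v
  lookup-defect t x v = lookup∘tabulate _ v

  defect-bilinear : ∀ s s′ x y → defect (s ⊕ˢ s′) (x ⊕ y) ≡ defect s x ⊕ defect s′ y
  defect-bilinear s s′ x y = vec-ext λ v → begin
    lookup (defect (s ⊕ˢ s′) (x ⊕ y)) v
      ≡⟨ lookup-defect (s ⊕ˢ s′) (x ⊕ y) v ⟩
    chainBAN C (s ⊕ˢ s′) v (x ⊕ y) xor lookup (x ⊕ y) v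
      ≡⟨ cong₂ _xor_ (chainBAN-bilinear s s′ v x y) (lookup-⊕ x y v) ⟩
    (chainBAN C s v x xor chainBAN C s′ v y) xor (lookup x v xor lookup y v)
      ≡⟨ xor-interchange (chainBAN C s v x) _ _ _ ⟩
    (chainBAN C s v x xor lookup x v) xor (chainBAN C s′ v y xor lookup y v)
      ≡⟨ sym (cong₂ _xor_ (lookup-defect s x v) (lookup-defect s′ y v)) ⟩
    lookup (defect s x) v xor lookup (defect s′ y) v
      ≡⟨ sym (lookup-⊕ (defect s x) (defect s′ y) v) ⟩
    lookup (defect s x ⊕ defect s′ y) v
      ∎
    where open ≡-Reasoning

  defect≡𝟎⇒fixed : ∀ t x → defect t x ≡ 𝟎 → IsFixed t x
  defect≡𝟎⇒fixed t x defect≡𝟎 v =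
    xor≡false⇒≡ (trans (sym (lookup-defect t x v)) (trans (cong (λ z → lookup z v) defect≡𝟎) (lookup-replicate v false)))

  -- the linear part A ⊕ id, and the constant part of the network with signs t
  δ : Vec Bool n → Vec Bool n
  δ = defect 𝟎ˢ

  offset : Signs len → Vec Bool n
  offset t = defect t 𝟎

  δ-linear : Linear δ
  δ-linear = defect-bilinear 𝟎ˢ 𝟎ˢ

  offset-linear : ∀ s s′ → offset (s ⊕ˢ s′) ≡ offset s ⊕ offset s′
  offset-linear s s′ = trans (cong (defect (s ⊕ˢ s′)) (sym (⊕-self 𝟎))) (defect-bilinear s s′ 𝟎 𝟎)

  offset-⊕𝟎ˢ : ∀ s → offset (s ⊕ˢ 𝟎ˢ) ≡ offset s
  offset-⊕𝟎ˢ s = trans (offset-linear s 𝟎ˢ) (trans (cong (offset s ⊕_) (linear-𝟎 δ-linear)) (⊕-identityʳ (offset s)))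

  solution⇒fixed : ∀ t x → δ x ≡ offset t → IsFixed t x
  solution⇒fixed t x δx≡offset = defect≡𝟎⇒fixed t x (begin
    defect t x                       ≡⟨ tabulate-cong (λ v → cong (_xor lookup x v) (chainBAN-cong t (t ⊕ˢ 𝟎ˢ) t≗t⊕𝟎ˢ v x)) ⟩
    defect (t ⊕ˢ 𝟎ˢ) x              ≡⟨ cong (defect (t ⊕ˢ 𝟎ˢ)) (sym (⊕-identityˡ x)) ⟩
    defect (t ⊕ˢ 𝟎ˢ) (𝟎 ⊕ x)        ≡⟨ defect-bilinear t 𝟎ˢ 𝟎 x ⟩
    offset t ⊕ δ x                   ≡⟨ cong (offset t ⊕_) δx≡offset ⟩
    offset t ⊕ offset t              ≡⟨ ⊕-self (offset t) ⟩
    𝟎                                ∎)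
    where
    open ≡-Reasoning
    t≗t⊕𝟎ˢ : ∀ k j → t k j ≡ (t ⊕ˢ 𝟎ˢ) k j
    t≗t⊕𝟎ˢ k j = sym (xor-identityʳ (t k j))

  -- Translating configurations by a fixed point d of chainBAN C (s ⊕ˢ s′),
  -- while keeping the automata in place, is a behavioural isomorphism.
  fixed⇒BehIso : ∀ s s′ d → IsFixed (s ⊕ˢ s′) d → BehIso (chainBAN C s) (chainBAN C s′)
  fixed⇒BehIso s s′ d d-fixed = ↔-id (Fin n) , translation , commute
    where
    translation : Vec Bool n ↔ Vec Bool n
    translation = mk↔ₛ′ (_⊕ d) (_⊕ d) (λ x → ⊕-cancelʳ x d) (λ x → ⊕-cancelʳ x d)
    shifted : ∀ v x → chainBAN C s′ v (x ⊕ d) ≡ chainBAN C s v x xor lookup d v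
    shifted v x = trans (chainBAN-cong s′ (s ⊕ˢ (s ⊕ˢ s′)) (λ k j → sym (xor-cancelˡ (s k j) (s′ k j))) v (x ⊕ d))
                        (trans (chainBAN-bilinear s (s ⊕ˢ s′) v x d) (cong (chainBAN C s v x xor_) (d-fixed v)))
    commute : ∀ W x → update (chainBAN C s) W x ⊕ d ≡ update (chainBAN C s′) (image (↔-id (Fin n)) W) (x ⊕ d)
    commute W x = vec-ext pointwise
      where
      componentwise : ∀ i b → (if b then chainBAN C s i x else lookup x i) xor lookup d i
                              ≡ (if b then chainBAN C s′ i (x ⊕ d) else lookup (x ⊕ d) i)
      componentwise i true  = sym (shifted i x)
      componentwise i false = sym (lookup-⊕ x d i)
      pointwise : ∀ i → lookup (update (chainBAN C s) W x ⊕ d) i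
                      ≡ lookup (update (chainBAN C s′) (image (↔-id (Fin n)) W) (x ⊕ d)) i
      pointwise i = begin
        lookup (update (chainBAN C s) W x ⊕ d) i
          ≡⟨ lookup-⊕ (update (chainBAN C s) W x) d i ⟩
        lookup (update (chainBAN C s) W x) i xor lookup d i
          ≡⟨ cong (_xor lookup d i) (lookup∘tabulate _ i) ⟩
        (if lookup W i then chainBAN C s i x else lookup x i) xor lookup d i
          ≡⟨ componentwise i (lookup W i) ⟩
        (if lookup W i then chainBAN C s′ i (x ⊕ d) else lookup (x ⊕ d) i)
          ≡⟨ cong (λ b → if b then chainBAN C s′ i (x ⊕ d) else lookup (x ⊕ d) i) (sym (lookup∘tabulate (lookup W) i)) ⟩
        (if lookup (image (↔-id (Fin n)) W) i then chainBAN C s′ i (x ⊕ d) else lookup (x ⊕ d) i)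
          ≡⟨ sym (lookup∘tabulate _ i) ⟩
        lookup (update (chainBAN C s′) (image (↔-id (Fin n)) W) (x ⊕ d)) i
          ∎
          where open ≡-Reasoning

  -- With all literals positive, 𝟎 is a fixed point; hence chainBAN C 𝟎ˢ is not
  -- isomorphic to a network without fixed point.
  𝟎-fixed : IsFixed 𝟎ˢ 𝟎
  𝟎-fixed = defect≡𝟎⇒fixed 𝟎ˢ 𝟎 (linear-𝟎 δ-linear)

  noFixedPoint⇒¬BehIso : ∀ t → ¬ HasFixedPoint t → ¬ BehIso (chainBAN C 𝟎ˢ) (chainBAN C t)
  noFixedPoint⇒¬BehIso t noFix iso = noFix (BehIso-fixedPoint iso 𝟎 𝟎-fixed)

  -- Kernel of δ = fixed points of the unsigned network.
  Kernel : Vec Bool n → Set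
  Kernel z = IsFixed 𝟎ˢ z

  -- If the unsigned network has 𝟎 as its only fixed point, then δ is onto, every
  -- chainBAN C (s ⊕ˢ s′) has a fixed point, and all sign choices are isomorphic.
  oneClass : (∀ z → Kernel z → z ≡ 𝟎) → OneClass C
  oneClass ker s s′ = fromSolution (δ-onto (offset (s ⊕ˢ s′)))
    where
    δ-onto : ∀ y → ∃ λ d → δ d ≡ y
    δ-onto = trivialKernel⇒surjective δ δ-linear (λ z δz≡𝟎 → ker z (defect≡𝟎⇒fixed 𝟎ˢ z δz≡𝟎))
    fromSolution : (∃ λ d → δ d ≡ offset (s ⊕ˢ s′)) → BehIso (chainBAN C s) (chainBAN C s′)
    fromSolution (d , δd≡offset) = fixed⇒BehIso s s′ d (solution⇒fixed (s ⊕ˢ s′) d δd≡offset)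

  -- Suppose t₀ has no fixed point and every nonzero fixed point of the unsigned
  -- network is nonzero at v₀.  Then N x = δ (x with v₀ erased) ⊕ x_{v₀}·offset t₀ is
  -- injective, hence onto; solving N x ≡ offset s puts s in the class of 𝟎ˢ or of t₀.
  twoClasses : ∀ (v₀ : Fin n) (t₀ : Signs len) → ¬ HasFixedPoint t₀ →
               (∀ z → Kernel z → lookup z v₀ ≡ false → z ≡ 𝟎) → TwoClasses C
  twoClasses v₀ t₀ noFix ker = 𝟎ˢ , t₀ , noFixedPoint⇒¬BehIso t₀ noFix , classify
    where
    keep : Vec Bool n
    keep = tabulate λ i → not ⌊ i Fin.≟ v₀ ⌋

    erase : Vec Bool n → Vec Bool n
    erase x = zipWith _∧_ x keep

    lookup-erase : ∀ x i → lookup (erase x) i ≡ lookup x i ∧ not ⌊ i Fin.≟ v₀ ⌋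
    lookup-erase x i = trans (lookup-zipWith _∧_ i x keep) (cong (lookup x i ∧_) (lookup∘tabulate _ i))

    erase-v₀ : ∀ x → lookup (erase x) v₀ ≡ false
    erase-v₀ x with v₀ Fin.≟ v₀ | lookup-erase x v₀
    ... | yes _     | e = trans e (∧-zeroʳ (lookup x v₀))
    ... | no v₀≢v₀ | _ = ⊥-elim (v₀≢v₀ refl)

    erase-elsewhere : ∀ x i → i ≢ v₀ → lookup (erase x) i ≡ lookup x i
    erase-elsewhere x i i≢v₀ with i Fin.≟ v₀ | lookup-erase x i
    ... | yes i≡v₀ | _ = ⊥-elim (i≢v₀ i≡v₀)
    ... | no _     | e = trans e (∧-identityʳ (lookup x i))

    scale : Bool → Vec Bool n
    scale b = if b then offset t₀ else 𝟎

    scale-linear : ∀ a b → scale (a xor b) ≡ scale a ⊕ scale b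
    scale-linear false b     = sym (⊕-identityˡ (scale b))
    scale-linear true  false = sym (⊕-identityʳ (offset t₀))
    scale-linear true  true  = sym (⊕-self (offset t₀))

    N : Vec Bool n → Vec Bool n
    N x = δ (erase x) ⊕ scale (lookup x v₀)

    N-linear : Linear N
    N-linear x y = trans
      (cong₂ _⊕_ (trans (cong δ (zipWith-distribʳ ∧-distribʳ-xor keep x y)) (δ-linear (erase x) (erase y)))
                 (trans (cong scale (lookup-⊕ x y v₀)) (scale-linear (lookup x v₀) (lookup y v₀))))
      (⊕-interchange (δ (erase x)) (δ (erase y)) (scale (lookup x v₀)) (scale (lookup y v₀)))

    N-at : ∀ x {b} → lookup x v₀ ≡ b → N x ≡ δ (erase x) ⊕ scale b
    N-at x x-v₀ = cong (λ b → δ (erase x) ⊕ scale b) x-v₀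

    N-kernel : ∀ x → N x ≡ 𝟎 → x ≡ 𝟎
    N-kernel x Nx≡𝟎 = at-v₀ (lookup x v₀) refl
      where
      at-v₀ : ∀ b → lookup x v₀ ≡ b → x ≡ 𝟎
      at-v₀ true  x-v₀ =
        ⊥-elim (noFix (erase x , solution⇒fixed t₀ (erase x) (⊕≡𝟎⇒≡ (trans (sym (N-at x x-v₀)) Nx≡𝟎))))
      at-v₀ false x-v₀ = vec-ext pointwise
        where
        erased-zero : erase x ≡ 𝟎
        erased-zero = ker (erase x)
          (defect≡𝟎⇒fixed 𝟎ˢ (erase x) (trans (sym (⊕-identityʳ (δ (erase x)))) (trans (sym (N-at x x-v₀)) Nx≡𝟎)))
          (erase-v₀ x)
        pointwise : ∀ i → lookup x i ≡ lookup 𝟎 i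
        pointwise i with i Fin.≟ v₀
        ... | yes refl = trans x-v₀ (sym (lookup-replicate i false))
        ... | no i≢v₀ = trans (sym (erase-elsewhere x i i≢v₀)) (cong (λ z → lookup z i) erased-zero)

    classify : ∀ s → BehIso (chainBAN C s) (chainBAN C 𝟎ˢ) ⊎ BehIso (chainBAN C s) (chainBAN C t₀)
    classify s = fromPreimage (trivialKernel⇒surjective N N-linear N-kernel (offset s))
      where
      fromPreimage : (∃ λ x → N x ≡ offset s) →
                     BehIso (chainBAN C s) (chainBAN C 𝟎ˢ) ⊎ BehIso (chainBAN C s) (chainBAN C t₀)
      fromPreimage (x , Nx≡offset) = at-v₀ (lookup x v₀) refl
        where
        at-v₀ : ∀ b → lookup x v₀ ≡ b → BehIso (chainBAN C s) (chainBAN C 𝟎ˢ) ⊎ BehIso (chainBAN C s) (chainBAN C t₀)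
        at-v₀ false x-v₀ = inj₁ (fixed⇒BehIso s 𝟎ˢ (erase x) (solution⇒fixed (s ⊕ˢ 𝟎ˢ) (erase x)
          (trans (sym (⊕-identityʳ (δ (erase x)))) (trans (sym (N-at x x-v₀)) (trans Nx≡offset (sym (offset-⊕𝟎ˢ s)))))))
        at-v₀ true  x-v₀ = inj₂ (fixed⇒BehIso s t₀ (erase x) (solution⇒fixed (s ⊕ˢ t₀) (erase x)
          (trans (⊕-solveˡ (trans (sym (N-at x x-v₀)) Nx≡offset)) (sym (offset-linear s t₀)))))

fib : Bool → Bool → ℕ → Bool
fib a b zero          = a
fib a b (suc zero)    = b
fib a b (suc (suc j)) = fib a b (suc j) xor fib a b j

fib-period : ∀ a b q → fib a b (q * 3) ≡ a × fib a b (suc (q * 3)) ≡ b × fib a b (suc (suc (q * 3))) ≡ b xor a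
fib-period a b zero    = refl , refl , refl
fib-period a b (suc q) with fib-period a b q
... | at0 , at1 , at2 = at3 , at4 , cong₂ _xor_ at4 at3
  where
  at3 : fib a b (suc (suc (suc (q * 3)))) ≡ a
  at3 = trans (cong₂ _xor_ at2 at1) (trans (xor-comm (b xor a) b) (xor-cancelˡ b a))
  at4 : fib a b (suc (suc (suc (suc (q * 3))))) ≡ b
  at4 = trans (cong₂ _xor_ at3 at2) (trans (cong (a xor_) (xor-comm b a)) (xor-cancelˡ a b))

fib-false : ∀ j → fib false false j ≡ false
fib-false zero          = refl
fib-false (suc zero)    = refl
fib-false (suc (suc j)) = cong₂ _xor_ (fib-false (suc j)) (fib-false j)

follows-fib : ∀ (P : ℕ → Bool) N → (∀ j → suc (suc j) ≤ N → P (suc (suc j)) ≡ P (suc j) xor P j) →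
              ∀ j → j ≤ N → P j ≡ fib (P 0) (P 1) j
follows-fib P N rec zero    _       = refl
follows-fib P N rec (suc j) j+1≤N = proj₂ (pairs j j+1≤N)
  where
  pairs : ∀ j → suc j ≤ N → P j ≡ fib (P 0) (P 1) j × P (suc j) ≡ fib (P 0) (P 1) (suc j)
  pairs zero    _       = refl , refl
  pairs (suc j) j+2≤N with pairs j (ℕ.≤-trans (ℕ.n≤1+n (suc j)) j+2≤N)
  ... | at-j , at-j+1 = at-j+1 , trans (rec j j+2≤N) (cong₂ _xor_ at-j+1 at-j)

mod3 : ∀ x → ∃ λ q → x ≡ q * 3 ⊎ x ≡ suc (q * 3) ⊎ x ≡ suc (suc (q * 3))
mod3 zero = 0 , inj₁ refl
mod3 (suc x) with mod3 x
... | q , inj₁ x≡3q             = q , inj₂ (inj₁ (cong suc x≡3q))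
... | q , inj₂ (inj₁ x≡3q+1)     = q , inj₂ (inj₂ (cong suc x≡3q+1))
... | q , inj₂ (inj₂ x≡3q+2)     = suc q , inj₁ (cong suc x≡3q+2)

pulse : Bool → ℕ → Bool
pulse false _       = false
pulse true  zero    = true
pulse true  (suc _) = false

pulse-suc : ∀ τ j → pulse τ (suc j) ≡ false
pulse-suc false j = refl
pulse-suc true  j = refl

-- The boundary-value problem satisfied by the values Y 0 … Y ℓ of a fixed point at
-- the intersections of a chain of ℓ + 2 cycles (τ = the sign at the first
-- intersection, Y (ℓ + 1) = Y ℓ the clamped boundary value).  Shifting by one,
-- P j = pulse τ j ⊕ Y (j - 1) obeys the period-3 recurrence, with P ℓ = 0.
module BoundaryRecurrence (ℓ : ℕ) (τ : Bool) (Y : ℕ → Bool) (clamp : Y (suc ℓ) ≡ Y ℓ)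
                          (equation : ∀ i → i ≤ ℓ → Y i ≡ (pulse τ i xor Y (pred i)) xor Y (suc i)) where

  P : ℕ → Bool
  P j = pulse τ j xor Y (pred j)

  P-suc : ∀ j → P (suc j) ≡ Y j
  P-suc j = cong (_xor Y j) (pulse-suc τ j)

  P-recurrence : ∀ j → suc (suc j) ≤ suc (suc ℓ) → P (suc (suc j)) ≡ P (suc j) xor P j
  P-recurrence j (s≤s (s≤s j≤ℓ)) = begin
    P (suc (suc j))           ≡⟨ P-suc (suc j) ⟩
    Y (suc j)                 ≡⟨ sym (xor-cancelˡ (P j) (Y (suc j))) ⟩
    P j xor (P j xor Y (suc j)) ≡⟨ cong (P j xor_) (sym (equation j j≤ℓ)) ⟩
    P j xor Y j               ≡⟨ xor-comm (P j) (Y j) ⟩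
    Y j xor P j               ≡⟨ cong (_xor P j) (sym (P-suc j)) ⟩
    P (suc j) xor P j         ∎
    where open ≡-Reasoning

  P-last : P ℓ ≡ false
  P-last = begin
    P ℓ                        ≡⟨ sym (xor-cancelʳ (P ℓ) (Y ℓ)) ⟩
    (P ℓ xor Y ℓ) xor Y ℓ      ≡⟨ cong (λ y → (P ℓ xor y) xor Y ℓ) (sym clamp) ⟩
    (P ℓ xor Y (suc ℓ)) xor Y ℓ ≡⟨ cong (_xor Y ℓ) (sym (equation ℓ ℕ.≤-refl)) ⟩
    Y ℓ xor Y ℓ                ≡⟨ xor-same (Y ℓ) ⟩
    false                      ∎
    where open ≡-Reasoning

  P-fib : ∀ j → j ≤ suc (suc ℓ) → P j ≡ fib (P 0) (P 1) j
  P-fib = follows-fib P (suc (suc ℓ)) P-recurrence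

  P-fib-last : P ℓ ≡ fib (P 0) (P 1) ℓ
  P-fib-last = P-fib ℓ (ℕ.≤-trans (ℕ.n≤1+n ℓ) (ℕ.n≤1+n (suc ℓ)))

  vanishes : τ ≡ false → Y 0 ≡ false → ∀ i → i ≤ ℓ → Y i ≡ false
  vanishes refl Y0≡0 i i≤ℓ = begin
    Y i                       ≡⟨ sym (P-suc i) ⟩
    P (suc i)                 ≡⟨ P-fib (suc i) (s≤s (ℕ.m≤n⇒m≤1+n i≤ℓ)) ⟩
    fib (Y 0) (Y 0) (suc i)   ≡⟨ cong (λ y → fib y y (suc i)) Y0≡0 ⟩
    fib false false (suc i)   ≡⟨ fib-false (suc i) ⟩
    false                     ∎
    where open ≡-Reasoning

  vanishes-at-0 : τ ≡ false → ¬ 3 ∣ suc ℓ → Y 0 ≡ false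
  vanishes-at-0 refl 3∤ with mod3 ℓ
  ... | q , inj₁ refl               = trans (sym (proj₁ (fib-period (Y 0) (Y 0) q))) (trans (sym P-fib-last) P-last)
  ... | q , inj₂ (inj₁ refl)        = trans (sym (proj₁ (proj₂ (fib-period (Y 0) (Y 0) q)))) (trans (sym P-fib-last) P-last)
  ... | q , inj₂ (inj₂ refl)        = ⊥-elim (3∤ (divides (suc q) refl))

  no-solution : τ ≡ true → ¬ 3 ∣ suc ℓ
  no-solution refl (divides (suc q) refl) = true≢false (begin
    true                                  ≡⟨ sym (xor-inverseʳ (Y 0)) ⟩
    Y 0 xor (true xor Y 0)                ≡⟨ sym (proj₂ (proj₂ (fib-period (true xor Y 0) (Y 0) q))) ⟩
    fib (true xor Y 0) (Y 0) ℓ            ≡⟨ sym P-fib-last ⟩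
    P ℓ                                   ≡⟨ P-last ⟩
    false                                 ∎)
    where open ≡-Reasoning

module ChainGeometry {n m} (len : Fin m → ℕ) (C : (k : Fin m) → Vec (Fin n) (suc (len k)))
                     (chain : IsChain len C) where
  open IsChain chain
  open SignedNetworks C

  On : Fin m → Fin n → Set
  On = OnCycle C

  On? : ∀ k v → Dec (On k v)
  On? k v = Fin.any? (λ j → lookup (C k) j Fin.≟ v)

  consecutive : ∀ {k k′ v} → On k v → On k′ v → k ≢ k′ → toℕ k′ ≡ suc (toℕ k) ⊎ toℕ k ≡ suc (toℕ k′)
  consecutive {k} {k′} {v} on on′ k≢k′ with ℕ.<-cmp (toℕ k) (toℕ k′)
  ... | tri≈ _ k≡k′ _ = ⊥-elim (k≢k′ (Fin.toℕ-injective k≡k′))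
  ... | tri< k<k′ _ _ with ℕ.m≤n⇒m<n∨m≡n k<k′
  ...   | inj₁ far  = ⊥-elim (disjoint k k′ far v on on′)
  ...   | inj₂ next = inj₁ (sym next)
  consecutive {k} {k′} {v} on on′ k≢k′ | tri> _ _ k′<k with ℕ.m≤n⇒m<n∨m≡n k′<k
  ...   | inj₁ far  = ⊥-elim (disjoint k′ k far v on′ on)
  ...   | inj₂ next = inj₂ (sym next)

  cycle : (c : ℕ) → .(c < m) → Fin m
  cycle c c<m = fromℕ< c<m

  cycle-toℕ : ∀ {k c} .(c<m : c < m) → toℕ k ≡ c → cycle c c<m ≡ k
  cycle-toℕ c<m k≡c = Fin.toℕ-injective (trans (Fin.toℕ-fromℕ< c<m) (sym k≡c))

  onCycle : ∀ {k c v} .(c<m : c < m) → toℕ k ≡ c → On k v → On (cycle c c<m) v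
  onCycle {v = v} c<m k≡c = subst (λ k′ → On k′ v) (sym (cycle-toℕ c<m k≡c))

  lower : ∀ {i} → suc i < m → i < m
  lower {i} p = ℕ.<-trans (ℕ.n<1+n i) p

  module _ (i : ℕ) .(p : suc i < m) where
    left right : Fin m
    left  = cycle i (lower p)
    right = cycle (suc i) p

    toℕ-left : toℕ left ≡ i
    toℕ-left = Fin.toℕ-fromℕ< (lower p)

    toℕ-right : toℕ right ≡ suc i
    toℕ-right = Fin.toℕ-fromℕ< p

    private
      meeting : ∃ λ o → On left o × On right o × (∀ v → On left v → On right v → v ≡ o)
      meeting = meet left right (trans toℕ-right (cong suc (sym toℕ-left)))

    o : Fin n
    o = proj₁ meeting

    o-left : On left o
    o-left = proj₁ (proj₂ meeting)

    o-right : On right o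
    o-right = proj₁ (proj₂ (proj₂ meeting))

    o-unique : ∀ v → On left v → On right v → v ≡ o
    o-unique = proj₂ (proj₂ (proj₂ meeting))

    left≢right : left ≢ right
    left≢right left≡right = ℕ.1+n≢n (sym (trans (sym toℕ-left) (trans (cong toℕ left≡right) toℕ-right)))

    -- o i lies on its two cycles only: a third one would be i - 1, which is disjoint from i + 1
    o-cycles : ∀ k → On k o → k ≡ left ⊎ k ≡ right
    o-cycles k on with k Fin.≟ left
    ... | yes k≡left = inj₁ k≡left
    ... | no k≢left with consecutive o-left on (k≢left ∘ sym)
    ...   | inj₁ k≡1+i = inj₂ (Fin.toℕ-injective (trans k≡1+i (trans (cong suc toℕ-left) (sym toℕ-right))))
    ...   | inj₂ i≡1+k = ⊥-elim (disjoint k right beyond o on o-right)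
      where
      beyond : suc (toℕ k) < toℕ right
      beyond = subst₂ _<_ (trans (sym toℕ-left) i≡1+k) (sym toℕ-right) (ℕ.n<1+n i)

  Shared : Fin m → Fin n → Set
  Shared k v = ∃ λ k′ → k′ ≢ k × On k′ v

  Shared? : ∀ k v → Dec (Shared k v)
  Shared? k v = Fin.any? (λ k′ → ¬? (k′ Fin.≟ k) ×-dec On? k′ v)

  shared⇒intersection : ∀ {k v} → On k v → Shared k v →
                        ∃₂ λ i (p : suc i < m) → v ≡ o i p × (toℕ k ≡ i ⊎ toℕ k ≡ suc i)
  shared⇒intersection {k} {v} on (k′ , k′≢k , on′) with consecutive on on′ (k′≢k ∘ sym)
  ... | inj₁ k′≡1+k = toℕ k , p , o-unique (toℕ k) p v (onCycle _ refl on) (onCycle p k′≡1+k on′) , inj₁ refl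
    where
    p : suc (toℕ k) < m
    p = subst (_< m) k′≡1+k (Fin.toℕ<n k′)
  ... | inj₂ k≡1+k′ = toℕ k′ , p , o-unique (toℕ k′) p v (onCycle _ refl on′) (onCycle p k≡1+k′ on) , inj₂ k≡1+k′
    where
    p : suc (toℕ k′) < m
    p = subst (_< m) k≡1+k′ (Fin.toℕ<n k)

  o-shared : ∀ i (p : suc i < m) k → On k (o i p) → Shared k (o i p)
  o-shared i p k on with o-cycles i p k on
  ... | inj₁ refl = right i p , left≢right i p ∘ sym , o-right i p
  ... | inj₂ refl = left i p , left≢right i p , o-left i p

  incoming : Signs len → Vec Bool n → (k : Fin m) → Fin (suc (len k)) → Bool
  incoming t x k j = t k j xor lookup x (lookup (C k) (predPos j))

  private
    cycleSum : Signs len → Vec Bool n → Fin n → Fin m → Bool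
    cycleSum t x v k = xorSum (arcTerm t x v k)

    cycleSum-off : ∀ t x v k → ¬ On k v → cycleSum t x v k ≡ false
    cycleSum-off t x v k ¬on = xorSum-vanishing (arcTerm t x v k) off
      where
      off : ∀ j → arcTerm t x v k j ≡ false
      off j with lookup (C k) j Fin.≟ v
      ... | yes on = ⊥-elim (¬on (j , on))
      ... | no _   = refl

    cycleSum-at : ∀ t x v k j → lookup (C k) j ≡ v → cycleSum t x v k ≡ incoming t x k j
    cycleSum-at t x v k j at = trans (xorSum-single (arcTerm t x v k) j off) here
      where
      off : ∀ j′ → j′ ≢ j → arcTerm t x v k j′ ≡ false
      off j′ j′≢j with lookup (C k) j′ Fin.≟ v
      ... | yes at′ = ⊥-elim (j′≢j (simple k j′ j (trans at′ (sym at))))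
      ... | no _    = refl
      here : arcTerm t x v k j ≡ incoming t x k j
      here with lookup (C k) j Fin.≟ v
      ... | yes _  = refl
      ... | no ¬at = ⊥-elim (¬at at)

  local-unshared : ∀ t x k j → ¬ Shared k (lookup (C k) j) → chainBAN C t (lookup (C k) j) x ≡ incoming t x k j
  local-unshared t x k j ¬shared =
    trans (xorSum-single (cycleSum t x _) k (λ k′ k′≢k → cycleSum-off t x _ k′ (λ on′ → ¬shared (k′ , k′≢k , on′))))
          (cycleSum-at t x _ k j refl)

  local-intersection : ∀ t x i (p : suc i < m) →
                       chainBAN C t (o i p) x ≡ incoming t x (left i p) (proj₁ (o-left i p))
                                                 xor incoming t x (right i p) (proj₁ (o-right i p))
  local-intersection t x i p =
    trans (xorSum-pair (cycleSum t x (o i p)) (left i p) (right i p) (left≢right i p) off)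
          (cong₂ _xor_ (cycleSum-at t x _ _ _ (proj₂ (o-left i p))) (cycleSum-at t x _ _ _ (proj₂ (o-right i p))))
    where
    off : ∀ k → k ≢ left i p → k ≢ right i p → cycleSum t x (o i p) k ≡ false
    off k k≢left k≢right = cycleSum-off t x _ k λ on → [ k≢left , k≢right ]′ (o-cycles i p k on)

  o-position : ∀ {k} i (p : suc i < m) → On k (o i p) → ∃ λ j → Shared k (lookup (C k) j)
  o-position {k} i p (j , at) = j , subst (Shared k) (sym at) (o-shared i p k (j , at))

  o-cong : ∀ {i i′} .{p : suc i < m} .{p′ : suc i′ < m} → i ≡ i′ → o i p ≡ o i′ p′
  o-cong refl = refl

  module Clamped (1<m : 1 < m) where

    private
      last<m : ∀ {m} → 1 < m → suc (m ∸ 2) < m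
      last<m {suc zero}    (s≤s ())
      last<m {suc (suc m)} _ = ℕ.n<1+n (suc m)

      last-index : ∀ {i m} → suc i < m → ¬ suc (suc i) < m → m ∸ 2 ≡ i
      last-index {i} {suc (suc m)} (s≤s (s≤s i≤m)) ¬beyond with ℕ.m≤n⇒m<n∨m≡n i≤m
      ... | inj₁ i<m = ⊥-elim (¬beyond (s≤s (s≤s i<m)))
      ... | inj₂ i≡m = sym i≡m

    O : ℕ → Fin n
    O i with suc i ℕ.<? m
    ... | yes p = o i p
    ... | no _  = o (m ∸ 2) (last<m 1<m)

    O-inRange : ∀ i (p : suc i < m) → O i ≡ o i p
    O-inRange i p with suc i ℕ.<? m
    ... | yes _ = refl
    ... | no ¬p = ⊥-elim (¬p p)

    O-beyondLast : ∀ i (p : suc i < m) → ¬ suc (suc i) < m → O (suc i) ≡ o i p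
    O-beyondLast i p ¬q with suc (suc i) ℕ.<? m
    ... | yes q = ⊥-elim (¬q q)
    ... | no _  = o-cong (last-index p ¬q)

    O-pred-left : ∀ i (p : suc i < m) → On (left i p) (O (pred i))
    O-pred-left zero    p = subst (On (left 0 p)) (sym (O-inRange 0 p)) (o-left 0 p)
    O-pred-left (suc i) p = subst (On (left (suc i) p)) (sym (O-inRange i (lower p))) (o-right i (lower p))

    O-suc-right : ∀ i (p : suc i < m) → On (right i p) (O (suc i))
    O-suc-right i p = byRange (suc (suc i) ℕ.<? m)
      where
      byRange : Dec (suc (suc i) < m) → On (right i p) (O (suc i))
      byRange (yes q) = subst (On (right i p)) (sym (O-inRange (suc i) q)) (o-left (suc i) q)
      byRange (no ¬q) = subst (On (right i p)) (sym (O-beyondLast i p ¬q)) (o-right i p)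

    shared-left : ∀ i (p : suc i < m) u → On (left i p) u → Shared (left i p) u → u ≡ o i p ⊎ u ≡ O (pred i)
    shared-left i p u on shared with shared⇒intersection on shared
    ... | i′ , p′ , u≡o , inj₁ i≡i′    = inj₁ (trans u≡o (o-cong (trans (sym i≡i′) (toℕ-left i p))))
    ... | i′ , p′ , u≡o , inj₂ i≡1+i′ =
      inj₂ (trans u≡o (trans (sym (O-inRange i′ p′)) (cong (O ∘ pred) (trans (sym i≡1+i′) (toℕ-left i p)))))

    shared-right : ∀ i (p : suc i < m) u → On (right i p) u → Shared (right i p) u → u ≡ o i p ⊎ u ≡ O (suc i)
    shared-right i p u on shared with shared⇒intersection on shared
    ... | i′ , p′ , u≡o , inj₁ 1+i≡i′  =
      inj₂ (trans u≡o (trans (sym (O-inRange i′ p′)) (cong O (trans (sym 1+i≡i′) (toℕ-right i p)))))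
    ... | i′ , p′ , u≡o , inj₂ 1+i≡1+i′ =
      inj₁ (trans u≡o (o-cong (ℕ.suc-injective (trans (sym 1+i≡1+i′) (toℕ-right i p)))))

    cycle-shared : ∀ k → ∃ λ j → Shared k (lookup (C k) j)
    cycle-shared k with suc (toℕ k) ℕ.<? m
    ... | yes p = o-position (toℕ k) p (subst (λ k′ → On k′ (o (toℕ k) p)) (cycle-toℕ _ refl) (o-left (toℕ k) p))
    ... | no ¬p = below-last (toℕ k) refl ¬p
      where
      below-last : ∀ c → toℕ k ≡ c → ¬ suc c < m → ∃ λ j → Shared k (lookup (C k) j)
      below-last zero    _   ¬p = ⊥-elim (¬p 1<m)
      below-last (suc i) k≡c _  = o-position i p (subst (λ k′ → On k′ (o i p)) (cycle-toℕ p k≡c) (o-right i p))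
        where
        p : suc i < m
        p = subst (_< m) k≡c (Fin.toℕ<n k)

  module ChainFixedPoint (t : Signs len) (t-unshared : ∀ k j → ¬ Shared k (lookup (C k) j) → t k j ≡ false)
                         (d : Vec Bool n) (d-fixed : IsFixed t d) where

    label : (k : Fin m) → Fin (suc (len k)) → Bool
    label k j = lookup d (lookup (C k) j)

    label-step : ∀ k j → ¬ Shared k (lookup (C k) j) → label k j ≡ label k (predPos j)
    label-step k j ¬shared =
      trans (sym (d-fixed _)) (trans (local-unshared t d k j ¬shared) (cong (_xor label k (predPos j)) (t-unshared k j ¬shared)))

    label-before : ∀ k a w → Shared k (lookup (C k) a) → On k w →
                   (∀ u → On k u → Shared k u → u ≡ lookup (C k) a ⊎ u ≡ w) → label k (predPos a) ≡ lookup d w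
    label-before k a w a-shared (b , at-b) others =
      trans (label-before-special (λ j → Shared k (lookup (C k) j)) (λ j → Shared? k (lookup (C k) j))
                                  (label k) (label-step k) a b a-shared onlyAB)
            (cong (lookup d) at-b)
      where
      onlyAB : ∀ j → Shared k (lookup (C k) j) → j ≡ a ⊎ j ≡ b
      onlyAB j shared with others (lookup (C k) j) (j , refl) shared
      ... | inj₁ at-a = inj₁ (simple k j a at-a)
      ... | inj₂ at-w = inj₂ (simple k j b (trans at-w (sym at-b)))

    module Intersections (1<m : 1 < m) where
      open Clamped 1<m

      Y : ℕ → Bool
      Y i = lookup d (O i)

      Y-clamp : ∀ i (p : suc i < m) → ¬ suc (suc i) < m → Y (suc i) ≡ Y i
      Y-clamp i p ¬q = cong (lookup d) (trans (O-beyondLast i p ¬q) (sym (O-inRange i p)))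

      intersection-equation : ∀ i (p : suc i < m) →
        Y i ≡ (t (left i p) (proj₁ (o-left i p)) xor Y (pred i)) xor (t (right i p) (proj₁ (o-right i p)) xor Y (suc i))
      intersection-equation i p = begin
        Y i                                   ≡⟨ cong (lookup d) (O-inRange i p) ⟩
        lookup d (o i p)                      ≡⟨ sym (d-fixed (o i p)) ⟩
        chainBAN C t (o i p) d                ≡⟨ local-intersection t d i p ⟩
        incoming t d (left i p) a xor incoming t d (right i p) b
          ≡⟨ cong₂ (λ y y′ → (t (left i p) a xor y) xor (t (right i p) b xor y′))
                   (label-before (left i p) a (O (pred i)) a-shared (O-pred-left i p) others-left)
                   (label-before (right i p) b (O (suc i)) b-shared (O-suc-right i p) others-right) ⟩
        (t (left i p) a xor Y (pred i)) xor (t (right i p) b xor Y (suc i)) ∎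
        where
        open ≡-Reasoning
        a : Fin (suc (len (left i p)))
        a = proj₁ (o-left i p)
        b : Fin (suc (len (right i p)))
        b = proj₁ (o-right i p)
        a-shared : Shared (left i p) (lookup (C (left i p)) a)
        a-shared = subst (Shared (left i p)) (sym (proj₂ (o-left i p))) (o-shared i p _ (o-left i p))
        b-shared : Shared (right i p) (lookup (C (right i p)) b)
        b-shared = subst (Shared (right i p)) (sym (proj₂ (o-right i p))) (o-shared i p _ (o-right i p))
        others-left : ∀ u → On (left i p) u → Shared (left i p) u → u ≡ lookup (C (left i p)) a ⊎ u ≡ O (pred i)
        others-left u on shared with shared-left i p u on shared
        ... | inj₁ u≡o = inj₁ (trans u≡o (sym (proj₂ (o-left i p))))
        ... | inj₂ u≡O = inj₂ u≡O
        others-right : ∀ u → On (right i p) u → Shared (right i p) u → u ≡ lookup (C (right i p)) b ⊎ u ≡ O (suc i)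
        others-right u on shared with shared-right i p u on shared
        ... | inj₁ u≡o = inj₁ (trans u≡o (sym (proj₂ (o-right i p))))
        ... | inj₂ u≡O = inj₂ u≡O

      vanishing-at-intersections⇒𝟎 : (∀ i → suc i < m → Y i ≡ false) → d ≡ 𝟎
      vanishing-at-intersections⇒𝟎 Y≡0 = vec-ext λ v → trans (at v) (sym (lookup-replicate v false))
        where
        at : ∀ v → lookup d v ≡ false
        at v with cover v
        ... | k , j , refl with CycleLabelling.walk (λ j → Shared k (lookup (C k) j)) (λ j → Shared? k (lookup (C k) j))
                                                    (label k) (label-step k) (cycle-shared k) j
        ...   | s , shared , e with shared⇒intersection (s , refl) shared
        ...     | i , p , at-o , _ = trans e (trans (cong (lookup d) (trans at-o (sym (O-inRange i p)))) (Y≡0 i p))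

module SeveralCycles {n ℓ} (len : Fin (suc (suc ℓ)) → ℕ) (C : (k : Fin (suc (suc ℓ))) → Vec (Fin n) (suc (len k)))
                     (chain : IsChain len C) where
  open SignedNetworks C
  open ChainGeometry len C chain

  1<m : 1 < suc (suc ℓ)
  1<m = s≤s (s≤s z≤n)

  module Recurrence (t : Signs len) (τ : Bool)
                    (t-unshared : ∀ k j → ¬ Shared k (lookup (C k) j) → t k j ≡ false)
                    (t-left : ∀ i (p : suc i < suc (suc ℓ)) → t (left i p) (proj₁ (o-left i p)) ≡ pulse τ i)
                    (t-right : ∀ i (p : suc i < suc (suc ℓ)) → t (right i p) (proj₁ (o-right i p)) ≡ false)
                    (d : Vec Bool n) (d-fixed : IsFixed t d) where
    open ChainFixedPoint t t-unshared d d-fixed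
    open Intersections 1<m public

    equation : ∀ i → i ≤ ℓ → Y i ≡ (pulse τ i xor Y (pred i)) xor Y (suc i)
    equation i i≤ℓ = trans (intersection-equation i p)
      (cong₂ (λ σ σ′ → (σ xor Y (pred i)) xor (σ′ xor Y (suc i))) (t-left i p) (t-right i p))
      where
      p : suc i < suc (suc ℓ)
      p = s≤s (s≤s i≤ℓ)

    open BoundaryRecurrence ℓ τ Y (Y-clamp ℓ ℕ.≤-refl (ℕ.<-irrefl refl)) equation public

  kernel-trivial : ¬ 3 ∣ suc ℓ → ∀ z → Kernel z → z ≡ 𝟎
  kernel-trivial 3∤ z z-fixed =
    vanishing-at-intersections⇒𝟎 λ i p → vanishes refl (vanishes-at-0 refl 3∤) i (ℕ.≤-pred (ℕ.≤-pred p))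
    where open Recurrence 𝟎ˢ false (λ _ _ _ → refl) (λ _ _ → refl) (λ _ _ → refl) z z-fixed

  t₀ : Signs len
  t₀ zero    j = ⌊ lookup (C zero) j Fin.≟ o 0 1<m ⌋
  t₀ (suc k) j = false

  t₀-unshared : ∀ k j → ¬ Shared k (lookup (C k) j) → t₀ k j ≡ false
  t₀-unshared (suc k) j _ = refl
  t₀-unshared zero    j ¬shared with lookup (C zero) j Fin.≟ o 0 1<m
  ... | yes at-o = ⊥-elim (¬shared (subst (Shared zero) (sym at-o) (o-shared 0 1<m zero (j , at-o))))
  ... | no _     = refl

  t₀-left : ∀ i (p : suc i < suc (suc ℓ)) → t₀ (left i p) (proj₁ (o-left i p)) ≡ pulse true i
  t₀-left (suc i) p = refl
  t₀-left zero    p with lookup (C zero) (proj₁ (o-left 0 p)) Fin.≟ o 0 1<m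
  ... | yes _     = refl
  ... | no ¬at-o  = ⊥-elim (¬at-o (proj₂ (o-left 0 p)))

  t₀-noFixedPoint : 3 ∣ suc ℓ → ¬ HasFixedPoint t₀
  t₀-noFixedPoint 3∣ (d , d-fixed) = no-solution refl 3∣
    where open Recurrence t₀ true t₀-unshared t₀-left (λ _ _ → refl) d d-fixed

  kernel-determined-at-o₀ : ∀ z → Kernel z → lookup z (o 0 1<m) ≡ false → z ≡ 𝟎
  kernel-determined-at-o₀ z z-fixed z₀≡0 =
    vanishing-at-intersections⇒𝟎 λ i p → vanishes refl Y₀≡0 i (ℕ.≤-pred (ℕ.≤-pred p))
    where
    open Recurrence 𝟎ˢ false (λ _ _ _ → refl) (λ _ _ → refl) (λ _ _ → refl) z z-fixed
    Y₀≡0 : Y 0 ≡ false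
    Y₀≡0 = trans (cong (lookup z) (Clamped.O-inRange 1<m 0 1<m)) z₀≡0

  classification : (¬ 3 ∣ suc ℓ → OneClass C) × (3 ∣ suc ℓ → TwoClasses C)
  classification = (λ 3∤ → oneClass (kernel-trivial 3∤))
                 , (λ 3∣ → twoClasses (o 0 1<m) t₀ (t₀-noFixedPoint 3∣) kernel-determined-at-o₀)

module SingleCycle {n} (len : Fin 1 → ℕ) (C : (k : Fin 1) → Vec (Fin n) (suc (len k))) (chain : IsChain len C) where
  open SignedNetworks C
  open ChainGeometry len C chain

  unshared : ∀ k v → ¬ Shared k v
  unshared zero v (zero , 0≢0 , _) = 0≢0 refl

  -- a fixed point of the unsigned network is constant along the cycle
  kernel-determined : ∀ z → Kernel z → lookup z (lookup (C zero) zero) ≡ false → z ≡ 𝟎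
  kernel-determined z z-fixed z₀≡0 = vec-ext λ v → trans (at v) (sym (lookup-replicate v false))
    where
    open ChainFixedPoint 𝟎ˢ (λ _ _ _ → refl) z z-fixed
    at : ∀ v → lookup z v ≡ false
    at v with IsChain.cover chain v
    ... | zero , j , refl with CycleLabelling.walk (λ j → j ≡ zero) (λ j → j Fin.≟ zero) (label zero)
                                                   (λ j _ → label-step zero j (unshared zero _)) (zero , refl) j
    ...   | .zero , refl , e = trans e z₀≡0

  t₁ : Signs len
  t₁ k zero    = true
  t₁ k (suc _) = false

  -- along the cycle a fixed point would have to flip exactly once
  t₁-noFixedPoint : ¬ HasFixedPoint t₁
  t₁-noFixedPoint (d , d-fixed) = true≢false (begin
    true              ≡⟨ sym (xorSum-single (t₁ zero) zero off) ⟩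
    xorSum (t₁ zero)  ≡⟨ sym (xorSum-cong jump≡t₁) ⟩
    xorSum (jump g)   ≡⟨ jumps-cancel g ⟩
    false             ∎)
    where
    open ≡-Reasoning
    g : Fin (suc (len zero)) → Bool
    g j = lookup d (lookup (C zero) j)
    jump≡t₁ : ∀ j → jump g j ≡ t₁ zero j
    jump≡t₁ j = trans (cong (_xor g (predPos j)) (trans (sym (d-fixed _)) (local-unshared t₁ d zero j (unshared zero _))))
                      (xor-cancelʳ (t₁ zero j) (g (predPos j)))
    off : ∀ j → j ≢ zero → t₁ zero j ≡ false
    off zero    0≢0 = ⊥-elim (0≢0 refl)
    off (suc j) _   = refl

  classification : (¬ 3 ∣ 0 → OneClass C) × (3 ∣ 0 → TwoClasses C)
  classification = (λ 3∤0 → ⊥-elim (3∤0 (3 ∣0)))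
                 , (λ _ → twoClasses (lookup (C zero) zero) t₁ t₁-noFixedPoint kernel-determined)

proposition4 : ∀ {n m : ℕ} (len : Fin m → ℕ)
                 (C : (k : Fin m) → Vec (Fin n) (suc (len k))) →
                 1 ≤ m → IsChain len C →
                 (¬ (3 ∣ (m ∸ 1)) → OneClass C) × (3 ∣ (m ∸ 1) → TwoClasses C)
proposition4 {m = zero}        len C ()  chain
proposition4 {m = suc zero}    len C _   chain = SingleCycle.classification len C chain
proposition4 {m = suc (suc ℓ)} len C _   chain = SeveralCycles.classification len C chain
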